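{- Let $\pi=\alpha\oplus(1\ominus\beta)\in\mathrm{Av}(231)$, with $\alpha,\beta\in\mathrm{Av}(231)$, be such that $P$ restricts to a bijection from $\mathrm{Av}(231,\pi)$ onto $\mathrm{Av}(132,P(\pi))$. Then $P$ restricts to a bijection from $\mathrm{Av}(231,\alpha)$ onto $\mathrm{Av}(132,P(\alpha))$, and $P$ restricts to a bijection from $\mathrm{Av}(231,\beta)$ onto $\mathrm{Av}(132,P(\beta))$.
   Context: Patterns. - $\mathrm{Av}(B)$ is the set of permutations avoiding every pattern in $B$. Sums and the bijection $P$. - $\alpha\oplus\beta=\alpha(\beta+|\alpha|)$ and $\alpha\ominus\beta=(\alpha+|\beta|)\beta$. - Every nonempty $\pi\in\mathrm{Av}(231)$ is uniquely $\alpha\oplus(1\ominus\beta)$ with $\alpha,\beta\in\mathrm{Av}(231)$, possibly empty. - $P:\mathrm{Av}(231)\to\mathrm{Av}(132)$ is the bijection defined by $P(\varepsilon)=\varepsilon$ and $P(\alpha\oplus(1\ominus\beta))=(P(\alpha)\oplus1)\ominus P(\beta)$. - "$P$ restricts to a bijection from $\mathrm{Av}(231,\tau)$ onto $\mathrm{Av}(132,P(\tau))$" means $P(\mathrm{Av}(231,\tau))=\mathrm{Av}(132,P(\tau))$. -}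

module Defs where

open import Data.Nat using (ℕ; zero; suc; _+_; _∸_; _<_; _≡ᵇ_)
open import Data.Bool using (not)
open import Data.List using (List; []; _∷_; _++_; map; length; applyUpTo; spanᵇ; drop; [_])
open import Data.List.Relation.Binary.Sublist.Propositional using (_⊆_)
open import Data.List.Relation.Binary.Permutation.Propositional using (_↭_)
open import Data.List.Relation.Binary.Pointwise using (Pointwise)
open import Data.List.Relation.Unary.All using (All)
open import Data.Product using (_×_; _,_; ∃)
open import Function.Bundles using (_⇔_)
open import Relation.Nullary using (¬_)
open import Relation.Binary.PropositionalEquality using (_≡_)

IsPerm : List ℕ → Set
IsPerm π = π ↭ applyUpTo suc (length π)

-- Order isomorphism of two sequences of distinct numbers:
-- every pair of positions i < j compares the same way in both.
data OrdIso : List ℕ → List ℕ → Set where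
  []  : OrdIso [] []
  _∷_ : ∀ {x y xs ys} →
        Pointwise (λ x' y' → (x < x') ⇔ (y < y')) xs ys →
        OrdIso xs ys → OrdIso (x ∷ xs) (y ∷ ys)

Contains : List ℕ → List ℕ → Set
Contains π σ = ∃ λ τ → τ ⊆ π × OrdIso τ σ

Av : List (List ℕ) → List ℕ → Set
Av B π = IsPerm π × All (λ σ → ¬ Contains π σ) B

_⊕_ : List ℕ → List ℕ → List ℕ
α ⊕ β = α ++ map (_+ length α) β

_⊖_ : List ℕ → List ℕ → List ℕ
α ⊖ β = map (_+ length β) α ++ β

infixl 6 _⊕_ _⊖_

p231 p132 : List ℕ
p231 = 2 ∷ 3 ∷ 1 ∷ []
p132 = 1 ∷ 3 ∷ 2 ∷ []

-- A nonempty π ∈ Av(231) of length n is uniquely α ⊕ (1 ⊖ β): α is the prefix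
-- before the maximum n, and β is the suffix after n, shifted down by |α|.
-- P(α ⊕ (1 ⊖ β)) = (P(α) ⊕ 1) ⊖ P(β). Recursion uses fuel = length
-- (values of P outside Av(231) are irrelevant).
Pfuel : ℕ → List ℕ → List ℕ
Pfuel zero    _  = []
Pfuel (suc k) [] = []
Pfuel (suc k) π@(_ ∷ _) with spanᵇ (λ x → not (x ≡ᵇ length π)) π
... | (L , rest) = (Pfuel k L ⊕ [ 1 ]) ⊖ Pfuel k (map (_∸ length L) (drop 1 rest))

P : List ℕ → List ℕ
P π = Pfuel (length π) π

RestrictsBij : List ℕ → Set
RestrictsBij τ =
  (∀ σ → Av (p231 ∷ τ ∷ []) σ → Av (p132 ∷ P τ ∷ []) (P σ)) ×
  (∀ ρ → Av (p132 ∷ P τ ∷ []) ρ → ∃ λ σ → Av (p231 ∷ τ ∷ []) σ × P σ ≡ ρ)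

-- A 231-avoider splits at its maximum as α ⊕ (1 ⊖ β) with α, β 231-avoiders, and P sends it to
-- (P α ⊕ 1) ⊖ P β; by induction P is an injection of Av(231) into Av(132).
-- Containment of patterns passes through these constructions in both directions: an occurrence of
-- α ⊕ (1 ⊖ β) in σ ⊕ (1 ⊖ β) puts, by counting, its α-part inside σ, and conversely an occurrence of α
-- in σ extends by the common remainder (the blocks lie above or below each other in the same way).
-- So if σ avoids 231 and α, then σ ⊕ (1 ⊖ β) avoids 231 and π, hence its image (P σ ⊕ 1) ⊖ P β avoids
-- P π, hence P σ avoids P α. Conversely, if ρ avoids 132 and P α, then (ρ ⊕ 1) ⊖ P β avoids 132 and
-- P π, so it is P σ′ for some σ′ avoiding 231 and π; writing σ′ = σ ⊕ (1 ⊖ β′), injectivity of P and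
-- of the skew decomposition give β′ = β and P σ = ρ, and σ avoids α. The summand β is symmetric.

module Submission where

open import Defs
open import Data.List using (List; [_])
open import Data.Nat using (ℕ)
open import Data.Product using (_×_)

open import Level using (0ℓ)
open import Data.Bool.Base using (Bool; true; false; not; T)
open import Data.Bool.Properties using (T-≡)
open import Data.Nat.Base using (zero; suc; _+_; _∸_; _<_; _≤_; _≡ᵇ_; s≤s; z≤n)
open import Data.Nat.Properties
  using (+-comm; ≤-reflexive; +-monoˡ-<; +-cancelʳ-<; <-asym; ≤-<-trans; m<n+m; m≤m+n; m≤n+m;
         ≤-trans; +-monoˡ-≤; suc-injective; ≤-refl; +-identityʳ; +-suc; n<1+n; <-trans; _≤?_; _<?_;
         m≤n⇒m≤1+n; m+[n∸m]≡n; <⇒≱; m∸n+n≡m; m+n≤o⇒m≤o; m+n≤o⇒n≤o; ≤-pred; ≡ᵇ⇒≡; ≡⇒≡ᵇ; <⇒≢;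
         +-cancelʳ-≡; m+n∸n≡m)
open import Data.List.Base using ([]; _∷_; _++_; map; length; applyUpTo; filter; drop; spanᵇ)
open import Data.List.Properties
  using (length-reverse; reverse-++; length-++; length-map; filter-++; filter-all; filter-none; ++-identityʳ;
         map-++; ++-assoc; map-∘; map-cong; map-id; map-injective; ∷-injectiveˡ; ∷-injectiveʳ)
open import Data.List.Extrema.Nat using (max; xs≤max; max<v⁺; max≤v⁺)
open import Data.List.Membership.Propositional using (_∈_)
open import Data.List.Membership.Propositional.Properties using (∈-∃++; ∈-++⁺ʳ)
open import Data.List.Relation.Binary.Sublist.Propositional using (_⊆_; []; _∷_; _∷ʳ_; ⊆-refl; ⊆-trans; from∈)
import Data.List.Relation.Binary.Sublist.Propositional.Properties as Sublist
open import Data.List.Relation.Binary.Permutation.Propositional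
  using (_↭_; ↭-refl; ↭-sym; ↭-trans; ↭-reflexive; module PermutationReasoning)
import Data.List.Relation.Binary.Permutation.Propositional.Properties as Perm
import Data.List.Relation.Binary.Pointwise as Pointwise
open Pointwise using (Pointwise; []; _∷_)
open import Data.List.Relation.Unary.All as All using (All; []; _∷_)
import Data.List.Relation.Unary.All.Properties as All
open import Data.List.Relation.Unary.Any using (here)
open import Data.Product using (_,_; ∃; ∃₂; proj₁; proj₂; map₁)
open import Data.Empty using (⊥-elim)
open import Function.Base using (_∘_)
open import Function.Bundles using (_⇔_; mk⇔; Equivalence)
open import Function.Properties.Equivalence using (⇔-isEquivalence)
open import Relation.Nullary using (¬_; contradiction)
open import Relation.Nullary.Decidable using (decidable-stable)
open import Relation.Unary using (Pred; Decidable; ∁)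
open import Relation.Unary.Properties using (∁?)
open import Relation.Binary.Structures using (IsEquivalence)
open import Relation.Binary.PropositionalEquality
  using (_≡_; _≢_; refl; sym; trans; cong; cong₂; subst; subst₂; module ≡-Reasoning)

private
  module ⇔ = IsEquivalence (⇔-isEquivalence {ℓ = 0ℓ})

private variable
  A B : Set
  k m n x y N : ℕ
  as bs as′ bs′ τ xs ys ws w w₁ w₂ p p₁ p₂ q L R σ σ′ α β α′ β′ ρ ρ′ : List ℕ

⊆-map⁻ : (f : A → B) (ys : List A) {ts : List B} → ts ⊆ map f ys →
         ∃ λ ts′ → ts′ ⊆ ys × ts ≡ map f ts′
⊆-map⁻ f []       []         = [] , [] , refl
⊆-map⁻ f (y ∷ ys) (_ ∷ʳ s)   with ts′ , s′ , refl ← ⊆-map⁻ f ys s = ts′ , y ∷ʳ s′ , refl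
⊆-map⁻ f (y ∷ ys) (refl ∷ s) with ts′ , s′ , refl ← ⊆-map⁻ f ys s = y ∷ ts′ , refl ∷ s′ , refl

⊆-++⁻ˡ : {as bs cs ds : List A} → length cs ≡ length ds → as ++ cs ⊆ bs ++ ds → as ⊆ bs
⊆-++⁻ˡ {as = as} {bs} {cs} {ds} eq s =
  Sublist.reverse⁻ (Sublist.++⁻ (trans (length-reverse cs) (trans eq (sym (length-reverse ds))))
                                (subst₂ _⊆_ (reverse-++ as cs) (reverse-++ bs ds) (Sublist.reverse⁺ s)))

⊆-++-split : ∀ (xs : List A) {ys ts} → ts ⊆ xs ++ ys → ∃₂ λ ts₁ ts₂ → ts ≡ ts₁ ++ ts₂ × ts₁ ⊆ xs × ts₂ ⊆ ys
⊆-++-split []       s          = [] , _ , refl , [] , s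
⊆-++-split (x ∷ xs) (_ ∷ʳ s)   with ts₁ , ts₂ , refl , s₁ , s₂ ← ⊆-++-split xs s =
  ts₁ , ts₂ , refl , x ∷ʳ s₁ , s₂
⊆-++-split (x ∷ xs) (refl ∷ s) with ts₁ , ts₂ , refl , s₁ , s₂ ← ⊆-++-split xs s =
  x ∷ ts₁ , ts₂ , refl , refl ∷ s₁ , s₂

OrdIso-refl : ∀ xs → OrdIso xs xs
OrdIso-refl []       = []
OrdIso-refl (x ∷ xs) = Pointwise.refl ⇔.refl ∷ OrdIso-refl xs

OrdIso-sym : OrdIso xs ys → OrdIso ys xs
OrdIso-sym []      = []
OrdIso-sym (r ∷ o) = Pointwise.symmetric ⇔.sym r ∷ OrdIso-sym o

OrdIso-trans : OrdIso xs ys → OrdIso ys ws → OrdIso xs ws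
OrdIso-trans []      []      = []
OrdIso-trans (r ∷ o) (s ∷ t) = Pointwise.transitive ⇔.trans r s ∷ OrdIso-trans o t

OrdIso-length : OrdIso xs ys → length xs ≡ length ys
OrdIso-length []      = refl
OrdIso-length (_ ∷ o) = cong suc (OrdIso-length o)

OrdIso-map : {f : ℕ → ℕ} → (∀ {x y} → (x < y) ⇔ (f x < f y)) → ∀ xs → OrdIso xs (map f xs)
OrdIso-map {f} mono []       = []
OrdIso-map {f} mono (x ∷ xs) = related xs ∷ OrdIso-map mono xs
  where
  related : ∀ ys → Pointwise (λ y y′ → (x < y) ⇔ (f x < y′)) ys (map f ys)
  related []       = []
  related (y ∷ ys) = mono ∷ related ys

+-mono-<-⇔ : ∀ k → (x < y) ⇔ (x + k < y + k)
+-mono-<-⇔ k = mk⇔ (+-monoˡ-< k) (+-cancelʳ-< _ _ _)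

OrdIso-shift : ∀ k xs → OrdIso xs (map (_+ k) xs)
OrdIso-shift k = OrdIso-map (+-mono-<-⇔ k)

_≺_ _≻_ : List ℕ → List ℕ → Set
xs ≺ ys = All (λ x → All (x <_) ys) xs
xs ≻ ys = All (λ x → All (_< x) ys) xs

≺-mono : ws ⊆ xs → τ ⊆ ys → xs ≺ ys → ws ≺ τ
≺-mono s t l = All.map (Sublist.All-resp-⊆ t) (Sublist.All-resp-⊆ s l)

≻-mono : ws ⊆ xs → τ ⊆ ys → xs ≻ ys → ws ≻ τ
≻-mono s t l = All.map (Sublist.All-resp-⊆ t) (Sublist.All-resp-⊆ s l)

data SameBlockOrder (as bs as′ bs′ : List ℕ) : Set where
  below : as ≺ bs → as′ ≺ bs′ → SameBlockOrder as bs as′ bs′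
  above : as ≻ bs → as′ ≻ bs′ → SameBlockOrder as bs as′ bs′

Pointwise-uniform : {P : A → Set} {Q : B → Set} {R : A → B → Set} → (∀ {y y′} → P y → Q y′ → R y y′) →
                    {as : List A} {bs : List B} → All P as → All Q bs → length as ≡ length bs → Pointwise R as bs
Pointwise-uniform r []       []       _  = []
Pointwise-uniform r (p ∷ ps) (q ∷ qs) eq = r p q ∷ Pointwise-uniform r ps qs (suc-injective eq)

Pointwise-++⁻ˡ : {R : A → B → Set} {as cs : List A} {bs ds : List B} → length as ≡ length bs →
                 Pointwise R (as ++ cs) (bs ++ ds) → Pointwise R as bs
Pointwise-++⁻ˡ {as = []}     {bs = []}     _  _        = []
Pointwise-++⁻ˡ {as = _ ∷ as} {bs = _ ∷ bs} eq (r ∷ rs) = r ∷ Pointwise-++⁻ˡ (suc-injective eq) rs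

OrdIso-++ : OrdIso as as′ → OrdIso bs bs′ → SameBlockOrder as bs as′ bs′ → OrdIso (as ++ bs) (as′ ++ bs′)
OrdIso-++ []      o′ _ = o′
OrdIso-++ (r ∷ o) o′ (below (l ∷ ls) (l′ ∷ ls′)) =
  Pointwise.++⁺ r (Pointwise-uniform (λ p q → mk⇔ (λ _ → q) (λ _ → p)) l l′ (OrdIso-length o′))
  ∷ OrdIso-++ o o′ (below ls ls′)
OrdIso-++ (r ∷ o) o′ (above (l ∷ ls) (l′ ∷ ls′)) =
  Pointwise.++⁺ r (Pointwise-uniform (λ p q → mk⇔ (λ x<y → ⊥-elim (<-asym x<y p)) (λ x<y → ⊥-elim (<-asym x<y q)))
                                     l l′ (OrdIso-length o′))
  ∷ OrdIso-++ o o′ (above ls ls′)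

OrdIso-split : ∀ p₁ {p₂} → OrdIso τ (p₁ ++ p₂) → ∃₂ λ τ₁ τ₂ → τ ≡ τ₁ ++ τ₂ × OrdIso τ₁ p₁ × OrdIso τ₂ p₂
OrdIso-split []       o       = [] , _ , refl , [] , o
OrdIso-split (_ ∷ p₁) (r ∷ o) with τ₁ , τ₂ , refl , o₁ , o₂ ← OrdIso-split p₁ o =
  _ ∷ τ₁ , τ₂ , refl , Pointwise-++⁻ˡ (OrdIso-length o₁) r ∷ o₁ , o₂

Contains-⊆ : xs ⊆ ys → Contains xs p → Contains ys p
Contains-⊆ s (τ , t , o) = τ , ⊆-trans t s , o

Contains-refl : ∀ xs → Contains xs xs
Contains-refl xs = xs , ⊆-refl , OrdIso-refl xs

Contains-OrdIso : Contains xs p → OrdIso p q → Contains xs q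
Contains-OrdIso (τ , s , o) o′ = τ , s , OrdIso-trans o o′

Contains-shiftˡ : ∀ k → Contains xs p → Contains (map (_+ k) xs) p
Contains-shiftˡ k (τ , s , o) =
  map (_+ k) τ , Sublist.map⁺ (_+ k) s , OrdIso-trans (OrdIso-sym (OrdIso-shift k τ)) o

Contains-shift : ∀ k l → Contains xs p → Contains (map (_+ k) xs) (map (_+ l) p)
Contains-shift {p = p} k l c = Contains-OrdIso (Contains-shiftˡ k c) (OrdIso-shift l p)

Contains-unshiftˡ : ∀ k → Contains (map (_+ k) xs) p → Contains xs p
Contains-unshiftˡ {xs} k (τ , s , o) with τ′ , s′ , refl ← ⊆-map⁻ (_+ k) xs s =
  τ′ , s′ , OrdIso-trans (OrdIso-shift k τ′) o

Contains-unshift : ∀ k l → Contains (map (_+ k) xs) (map (_+ l) p) → Contains xs p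
Contains-unshift {p = p} k l c = Contains-OrdIso (Contains-unshiftˡ k c) (OrdIso-sym (OrdIso-shift l p))

Contains-++ : Contains w₁ p₁ → Contains w₂ p₂ → SameBlockOrder w₁ w₂ p₁ p₂ → Contains (w₁ ++ w₂) (p₁ ++ p₂)
Contains-++ (τ₁ , s₁ , o₁) (τ₂ , s₂ , o₂) order = τ₁ ++ τ₂ , Sublist.++⁺ s₁ s₂ , OrdIso-++ o₁ o₂ (restrict order)
  where
  restrict : SameBlockOrder _ _ _ _ → SameBlockOrder τ₁ τ₂ _ _
  restrict (below l l′) = below (≺-mono s₁ s₂ l) l′
  restrict (above l l′) = above (≻-mono s₁ s₂ l) l′

Contains-++⁻ˡ : length p₂ ≡ length w₂ → Contains (w₁ ++ w₂) (p₁ ++ p₂) → Contains w₁ p₁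
Contains-++⁻ˡ {p₁ = p₁} eq (τ , s , o) with τ₁ , τ₂ , refl , o₁ , o₂ ← OrdIso-split p₁ o =
  τ₁ , ⊆-++⁻ˡ (trans (OrdIso-length o₂) eq) s , o₁

Contains-++⁻ʳ : length p₁ ≡ length w₁ → Contains (w₁ ++ w₂) (p₁ ++ p₂) → Contains w₂ p₂
Contains-++⁻ʳ {p₁ = p₁} eq (τ , s , o) with τ₁ , τ₂ , refl , o₁ , o₂ ← OrdIso-split p₁ o =
  τ₂ , Sublist.++⁻ (trans (OrdIso-length o₁) eq) s , o₂


length-⊕ : ∀ α β → length (α ⊕ β) ≡ length α + length β
length-⊕ α β = trans (length-++ α) (cong (length α +_) (length-map _ β))

length-⊖ : ∀ α β → length (α ⊖ β) ≡ length α + length β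
length-⊖ α β = trans (length-++ (map _ α)) (cong (_+ length β) (length-map _ α))

Contains-⊕⁻ˡ : ∀ β → Contains (α ⊕ β) (α′ ⊕ β) → Contains α α′
Contains-⊕⁻ˡ β = Contains-++⁻ˡ (trans (length-map _ β) (sym (length-map _ β)))

Contains-⊕⁻ʳ : ∀ α → Contains (α ⊕ β) (α ⊕ β′) → Contains β β′
Contains-⊕⁻ʳ α = Contains-unshift _ _ ∘ Contains-++⁻ʳ refl

Contains-⊖⁻ˡ : ∀ β → Contains (α ⊖ β) (α′ ⊖ β) → Contains α α′
Contains-⊖⁻ˡ β = Contains-unshift _ _ ∘ Contains-++⁻ˡ refl

Contains-⊖⁻ʳ : ∀ α → Contains (α ⊖ β) (α ⊖ β′) → Contains β β′
Contains-⊖⁻ʳ α = Contains-++⁻ʳ (trans (length-map _ α) (sym (length-map _ α)))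

Within : ℕ → List ℕ → Set
Within n = All (λ x → 0 < x × x ≤ n)

InRange : List ℕ → Set
InRange xs = Within (length xs) xs

⊕-≺ : ∀ {a b} → Within a α → Within b β → α ≺ map (_+ a) β
⊕-≺ {a = a} wα wβ = All.map (λ (_ , x≤a) → All.map⁺ (All.map (λ (0<y , _) → ≤-<-trans x≤a (m<n+m a 0<y)) wβ)) wα

⊖-≻ : ∀ {a b} → Within a α → Within b β → map (_+ b) α ≻ β
⊖-≻ {b = b} wα wβ = All.map⁺ (All.map (λ (0<x , _) → All.map (λ (_ , y≤b) → ≤-<-trans y≤b (m<n+m b 0<x)) wβ) wα)

Within-⊕ : ∀ {a b} → Within a α → Within b β → Within (a + b) (α ++ map (_+ a) β)
Within-⊕ {a = a} {b} wα wβ =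
  All.++⁺ (All.map (λ (0<x , x≤a) → 0<x , ≤-trans x≤a (m≤m+n a b)) wα)
          (All.map⁺ (All.map (λ {y} (0<y , y≤b) → ≤-trans 0<y (m≤m+n y a) ,
                                                  ≤-trans (+-monoˡ-≤ a y≤b) (≤-reflexive (+-comm b a))) wβ))

Within-⊖ : ∀ {a b} → Within a α → Within b β → Within (a + b) (map (_+ b) α ++ β)
Within-⊖ {a = a} {b} wα wβ =
  All.++⁺ (All.map⁺ (All.map (λ {x} (0<x , x≤a) → ≤-trans 0<x (m≤m+n x b) , +-monoˡ-≤ b x≤a) wα))
          (All.map (λ (0<y , y≤b) → 0<y , ≤-trans y≤b (m≤n+m b a)) wβ)

InRange-⊕ : InRange α → InRange β → InRange (α ⊕ β)
InRange-⊕ {α} {β} rα rβ = subst (λ n → Within n (α ⊕ β)) (sym (length-⊕ α β)) (Within-⊕ rα rβ)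

InRange-⊖ : InRange α → InRange β → InRange (α ⊖ β)
InRange-⊖ {α} {β} rα rβ = subst (λ n → Within n (α ⊖ β)) (sym (length-⊖ α β)) (Within-⊖ rα rβ)

Contains-⊕⁺ : InRange α → InRange α′ → InRange β → InRange β′ →
              Contains α α′ → Contains β β′ → Contains (α ⊕ β) (α′ ⊕ β′)
Contains-⊕⁺ rα rα′ rβ rβ′ cα cβ = Contains-++ cα (Contains-shift _ _ cβ) (below (⊕-≺ rα rβ) (⊕-≺ rα′ rβ′))

Contains-⊖⁺ : InRange α → InRange α′ → InRange β → InRange β′ →
              Contains α α′ → Contains β β′ → Contains (α ⊖ β) (α′ ⊖ β′)
Contains-⊖⁺ rα rα′ rβ rβ′ cα cβ = Contains-++ (Contains-shift _ _ cα) cβ (above (⊖-≻ rα rβ) (⊖-≻ rα′ rβ′))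

interval : ℕ → ℕ → List ℕ
interval a zero    = []
interval a (suc n) = suc a ∷ interval (suc a) n

applyUpTo≡interval : ∀ (f : ℕ → ℕ) a n → (∀ i → f i ≡ suc (a + i)) → applyUpTo f n ≡ interval a n
applyUpTo≡interval f a zero    _   = refl
applyUpTo≡interval f a (suc n) f≗ =
  cong₂ _∷_ (trans (f≗ 0) (cong suc (+-identityʳ a)))
            (applyUpTo≡interval (f ∘ suc) (suc a) n (λ i → trans (f≗ (suc i)) (cong suc (+-suc a i))))

length-interval : ∀ a n → length (interval a n) ≡ n
length-interval a zero    = refl
length-interval a (suc n) = cong suc (length-interval (suc a) n)

interval-++ : ∀ a m n → interval a (m + n) ≡ interval a m ++ interval (a + m) n
interval-++ a zero    n = cong (λ b → interval b n) (sym (+-identityʳ a))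
interval-++ a (suc m) n = cong (suc a ∷_) (trans (interval-++ (suc a) m n)
                                                 (cong (λ b → interval (suc a) m ++ interval b n) (sym (+-suc a m))))

interval-∷ʳ : ∀ a n → interval a (suc n) ≡ interval a n ++ [ suc (a + n) ]
interval-∷ʳ a n = trans (cong (interval a) (+-comm 1 n)) (interval-++ a n 1)

map-+-interval : ∀ k a n → map (_+ k) (interval a n) ≡ interval (a + k) n
map-+-interval k a zero    = refl
map-+-interval k a (suc n) = cong (suc (a + k) ∷_) (map-+-interval k (suc a) n)

interval-bounds : ∀ a n → All (λ x → a < x × x ≤ a + n) (interval a n)
interval-bounds a zero    = []
interval-bounds a (suc n) =
  (s≤s ≤-refl , ≤-trans (s≤s (m≤m+n a n)) (≤-reflexive (sym (+-suc a n)))) ∷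
  All.map (λ (a<x , x≤) → <-trans (n<1+n a) a<x , ≤-trans x≤ (≤-reflexive (sym (+-suc a n))))
          (interval-bounds (suc a) n)

toInterval : IsPerm xs → xs ↭ interval 0 (length xs)
toInterval {xs} = subst (xs ↭_) (applyUpTo≡interval suc 0 (length xs) (λ _ → refl))

fromInterval : xs ↭ interval 0 n → IsPerm xs
fromInterval {xs} {n} p =
  subst (xs ↭_) (sym (applyUpTo≡interval suc 0 (length xs) (λ _ → refl)))
        (subst (λ m → xs ↭ interval 0 m) (sym length≡n) p)
  where
  length≡n : length xs ≡ n
  length≡n = trans (Perm.↭-length p) (length-interval 0 n)

↭interval⇒Within : xs ↭ interval 0 n → Within n xs
↭interval⇒Within {n = n} p = Perm.All-resp-↭ (↭-sym p) (interval-bounds 0 n)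

IsPerm⇒InRange : IsPerm xs → InRange xs
IsPerm⇒InRange p = ↭interval⇒Within (toInterval p)

isPerm-[1] : IsPerm [ 1 ]
isPerm-[1] = ↭-refl

isPerm-⊕ : IsPerm α → IsPerm β → IsPerm (α ⊕ β)
isPerm-⊕ {α} {β} pα pβ = fromInterval (begin
  α ++ map (_+ a) β                            ↭⟨ Perm.++⁺ (toInterval pα) (Perm.map⁺ (_+ a) (toInterval pβ)) ⟩
  interval 0 a ++ map (_+ a) (interval 0 b)    ≡⟨ cong (interval 0 a ++_) (map-+-interval a 0 b) ⟩
  interval 0 a ++ interval a b                 ≡⟨ interval-++ 0 a b ⟨
  interval 0 (a + b)                           ∎)
  where
  open PermutationReasoning
  a b : ℕ
  a = length α
  b = length β

isPerm-⊖ : IsPerm α → IsPerm β → IsPerm (α ⊖ β)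
isPerm-⊖ {α} {β} pα pβ = fromInterval (begin
  map (_+ b) α ++ β                            ↭⟨ Perm.++⁺ (Perm.map⁺ (_+ b) (toInterval pα)) (toInterval pβ) ⟩
  map (_+ b) (interval 0 a) ++ interval 0 b    ≡⟨ cong (_++ interval 0 b) (map-+-interval b 0 a) ⟩
  interval b a ++ interval 0 b                 ↭⟨ Perm.++-comm (interval b a) (interval 0 b) ⟩
  interval 0 b ++ interval b a                 ≡⟨ interval-++ 0 b a ⟨
  interval 0 (b + a)                           ∎)
  where
  open PermutationReasoning
  a b : ℕ
  a = length α
  b = length β

2≮1 : ¬ 2 < 1
2≮1 (s≤s ())

3≮2 : ¬ 3 < 2
3≮2 (s≤s (s≤s ()))

-- The first letter of 231 exceeds the last one, so an occurrence cannot straddle two blocks w₁ ≺ w₂.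
avoid231-≺ : ¬ Contains w₁ p231 → ¬ Contains w₂ p231 → w₁ ≺ w₂ → ¬ Contains (w₁ ++ w₂) p231
avoid231-≺ {w₁} a₁ a₂ w₁≺w₂ (τ , s , o@((_ ∷ a<c⇔2<1 ∷ []) ∷ _)) with ⊆-++-split w₁ s
... | []              , _ , refl , _  , s₂ = a₂ (τ , s₂ , o)
... | _ ∷ []          , _ , refl , s₁ , s₂ with (_ ∷ a<c ∷ []) ∷ [] ← ≺-mono s₁ s₂ w₁≺w₂ =
  2≮1 (Equivalence.to a<c⇔2<1 a<c)
... | _ ∷ _ ∷ []      , _ , refl , s₁ , s₂ with (a<c ∷ []) ∷ _ ← ≺-mono s₁ s₂ w₁≺w₂ =
  2≮1 (Equivalence.to a<c⇔2<1 a<c)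
... | _ ∷ _ ∷ _ ∷ []  , _ , refl , s₁ , _  = a₁ (_ , s₁ , o)

avoid231-∷ : ¬ Contains w p231 → All (_< N) w → ¬ Contains (N ∷ w) p231
avoid231-∷ avoid w<N (τ , _ ∷ʳ s , o) = avoid (τ , s , o)
avoid231-∷ avoid w<N (_ , refl ∷ s , (N<b⇔2<3 ∷ _) ∷ _) with b<N ∷ _ ← Sublist.All-resp-⊆ s w<N =
  <-asym (Equivalence.from N<b⇔2<3 (s≤s (s≤s (s≤s z≤n)))) b<N

-- The first letter of 132 is below the last one, so an occurrence cannot straddle two blocks w₁ ≻ w₂.
avoid132-≻ : ¬ Contains w₁ p132 → ¬ Contains w₂ p132 → w₁ ≻ w₂ → ¬ Contains (w₁ ++ w₂) p132
avoid132-≻ {w₁} a₁ a₂ w₁≻w₂ (τ , s , o@((_ ∷ a<c⇔1<2 ∷ []) ∷ _)) with ⊆-++-split w₁ s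
... | []              , _ , refl , _  , s₂ = a₂ (τ , s₂ , o)
... | _ ∷ []          , _ , refl , s₁ , s₂ with (_ ∷ c<a ∷ []) ∷ [] ← ≻-mono s₁ s₂ w₁≻w₂ =
  <-asym c<a (Equivalence.from a<c⇔1<2 (s≤s (s≤s z≤n)))
... | _ ∷ _ ∷ []      , _ , refl , s₁ , s₂ with (c<a ∷ []) ∷ _ ← ≻-mono s₁ s₂ w₁≻w₂ =
  <-asym c<a (Equivalence.from a<c⇔1<2 (s≤s (s≤s z≤n)))
... | _ ∷ _ ∷ _ ∷ []  , _ , refl , s₁ , _  = a₁ (_ , s₁ , o)

avoid132-∷ʳ : ¬ Contains w p132 → All (_< N) w → ¬ Contains (w ++ [ N ]) p132
avoid132-∷ʳ {w} avoid w<N (τ , s , o@(_ ∷ (b<c⇔3<2 ∷ []) ∷ _)) with ⊆-++-split w s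
... | []              , _ ∷ _ ∷ _ ∷ [] , refl , _  , _ ∷ʳ ()
... | []              , _ ∷ _ ∷ _ ∷ [] , refl , _  , refl ∷ ()
... | _ ∷ []          , _ ∷ _ ∷ []     , refl , _  , _ ∷ʳ ()
... | _ ∷ []          , _ ∷ _ ∷ []     , refl , _  , refl ∷ ()
... | _ ∷ _ ∷ []      , _ ∷ []         , refl , s₁ , refl ∷ [] with _ ∷ b<N ∷ [] ← Sublist.All-resp-⊆ s₁ w<N =
  3≮2 (Equivalence.to b<c⇔3<2 b<N)
... | _ ∷ _ ∷ _ ∷ []  , []             , refl , s₁ , _ = avoid (_ , s₁ , o)

InRange⇒<suc-length : InRange xs → All (_< suc (length xs)) xs
InRange⇒<suc-length = All.map (λ (_ , x≤n) → s≤s x≤n)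

Av231-⊕-1⊖ : Av [ p231 ] α → Av [ p231 ] β → Av [ p231 ] (α ⊕ ([ 1 ] ⊖ β))
Av231-⊕-1⊖ {α} {β} (pα , avoidα ∷ []) (pβ , avoidβ ∷ []) =
  isPerm-⊕ pα p1⊖β ,
  avoid231-≺ avoidα (avoid231-∷ avoidβ (InRange⇒<suc-length (IsPerm⇒InRange pβ)) ∘ Contains-unshiftˡ (length α))
             (⊕-≺ (IsPerm⇒InRange pα) (IsPerm⇒InRange p1⊖β)) ∷ []
  where
  p1⊖β : IsPerm ([ 1 ] ⊖ β)
  p1⊖β = isPerm-⊖ isPerm-[1] pβ

Av132-⊕1-⊖ : Av [ p132 ] α → Av [ p132 ] β → Av [ p132 ] ((α ⊕ [ 1 ]) ⊖ β)
Av132-⊕1-⊖ {α} {β} (pα , avoidα ∷ []) (pβ , avoidβ ∷ []) =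
  isPerm-⊖ pα⊕1 pβ ,
  avoid132-≻ (avoid132-∷ʳ avoidα (InRange⇒<suc-length (IsPerm⇒InRange pα)) ∘ Contains-unshiftˡ (length β)) avoidβ
             (⊖-≻ (IsPerm⇒InRange pα⊕1) (IsPerm⇒InRange pβ)) ∷ []
  where
  pα⊕1 : IsPerm (α ⊕ [ 1 ])
  pα⊕1 = isPerm-⊕ pα isPerm-[1]

filter-++-keepˡ : {P : Pred A 0ℓ} (P? : Decidable P) {xs ys : List A} →
                  All P xs → All (∁ P) ys → filter P? (xs ++ ys) ≡ xs
filter-++-keepˡ P? {xs} {ys} p q =
  trans (filter-++ P? xs ys) (trans (cong₂ _++_ (filter-all P? p) (filter-none P? q)) (++-identityʳ xs))

filter-++-keepʳ : {P : Pred A 0ℓ} (P? : Decidable P) {xs ys : List A} →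
                  All (∁ P) xs → All P ys → filter P? (xs ++ ys) ≡ ys
filter-++-keepʳ P? {xs} {ys} q p = trans (filter-++ P? xs ys) (cong₂ _++_ (filter-none P? q) (filter-all P? p))

↭-partition : {P : Pred A 0ℓ} (P? : Decidable P) {xs ys xs′ ys′ : List A} → xs ++ ys ↭ xs′ ++ ys′ →
              All P xs → All (∁ P) ys → All P xs′ → All (∁ P) ys′ → xs ↭ xs′ × ys ↭ ys′
↭-partition {A = A} P? {xs} {ys} {xs′} {ys′} p pxs pys pxs′ pys′ =
  filtered P? (filter-++-keepˡ P? pxs pys) (filter-++-keepˡ P? pxs′ pys′) ,
  filtered (∁? P?) (filter-++-keepʳ (∁? P?) (¬¬ pxs) pys) (filter-++-keepʳ (∁? P?) (¬¬ pxs′) pys′)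
  where
  ¬¬ : ∀ {Q : Pred A 0ℓ} {zs} → All Q zs → All (∁ (∁ Q)) zs
  ¬¬ = All.map (λ q ¬q → ¬q q)
  filtered : ∀ {Q : Pred A 0ℓ} (Q? : Decidable Q) {zs zs′} →
             filter Q? (xs ++ ys) ≡ zs → filter Q? (xs′ ++ ys′) ≡ zs′ → zs ↭ zs′
  filtered Q? e e′ = subst₂ _↭_ e e′ (Perm.filter-↭ Q? p)

↭-interval-cut : L ++ R ↭ interval 0 m → L ≺ R →
                 ∃ λ c → c ≤ m × L ↭ interval 0 c × R ↭ interval c (m ∸ c)
↭-interval-cut {L} {R} {m} p L≺R =
  c , c≤m , ↭-partition (_≤? c) p′ L≤c (All.map <⇒≱ c<R)
                        (All.map proj₂ (interval-bounds 0 c)) (All.map (<⇒≱ ∘ proj₁) (interval-bounds c (m ∸ c)))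
  where
  bounds : Within m (L ++ R)
  bounds = ↭interval⇒Within p
  c : ℕ
  c = max 0 L
  L≤c : All (_≤ c) L
  L≤c = xs≤max 0 L
  c<R : All (c <_) R
  c<R = All.tabulate λ y∈R → max<v⁺ (proj₁ (All.lookup (All.++⁻ʳ L bounds) y∈R))
                                    (All.map (λ x<R → All.lookup x<R y∈R) L≺R)
  c≤m : c ≤ m
  c≤m = max≤v⁺ z≤n (All.map proj₂ (All.++⁻ˡ L bounds))
  p′ : L ++ R ↭ interval 0 c ++ interval c (m ∸ c)
  p′ = ↭-trans p (↭-reflexive (trans (cong (interval 0) (sym (m+[n∸m]≡n c≤m))) (interval-++ 0 c (m ∸ c))))

drop-max : L ++ [ suc m ] ++ R ↭ interval 0 (suc m) → L ++ R ↭ interval 0 m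
drop-max {L} {m} p =
  ↭-trans (Perm.drop-mid L (interval 0 m) (↭-trans p (↭-reflexive (interval-∷ʳ 0 m))))
          (↭-reflexive (++-identityʳ _))

OrdIso-231 : ∀ {x y} → x < N → ¬ x < y → y ≤ N → OrdIso (x ∷ N ∷ y ∷ []) p231
OrdIso-231 x<N x≮y y≤N =
  (mk⇔ (λ _ → s≤s (s≤s (s≤s z≤n))) (λ _ → x<N) ∷ mk⇔ (⊥-elim ∘ x≮y) (⊥-elim ∘ 2≮1) ∷ []) ∷
  (mk⇔ (λ N<y → ⊥-elim (<⇒≱ N<y y≤N)) (λ { (s≤s ()) }) ∷ []) ∷
  [] ∷ []

-- An inversion x > y across the maximum would form a 231 together with it.
avoid231⇒≺ : ¬ Contains (L ++ [ suc m ] ++ R) p231 → All (_≤ m) (L ++ R) → L ≺ R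
avoid231⇒≺ {L} {m} {R} avoid L++R≤m =
  All.tabulate λ x∈L → All.tabulate λ y∈R → decidable-stable (_ <? _) λ x≮y →
    avoid (_ , Sublist.++⁺ (from∈ x∈L) (refl ∷ from∈ y∈R) ,
           OrdIso-231 (s≤s (All.lookup (All.++⁻ˡ L L++R≤m) x∈L)) x≮y
                      (m≤n⇒m≤1+n (All.lookup (All.++⁻ʳ L L++R≤m) y∈R)))

decompose-at-max : L ++ [ suc m ] ++ R ↭ interval 0 (suc m) → ¬ Contains (L ++ [ suc m ] ++ R) p231 →
                   ∃₂ λ α β → L ++ [ suc m ] ++ R ≡ α ⊕ ([ 1 ] ⊖ β) × Av [ p231 ] α × Av [ p231 ] β
decompose-at-max {L} {m} {R} p avoid
  with c , c≤m , L↭ , R↭ ← ↭-interval-cut (drop-max p)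
                              (avoid231⇒≺ avoid (All.map proj₂ (↭interval⇒Within (drop-max p))))
  with β , refl , β↭ ← Perm.↭-map-inv (_+ c) (↭-trans (↭-reflexive (map-+-interval c 0 (m ∸ c))) (↭-sym R↭))
  = L , β , shape , (fromInterval L↭ , avoid ∘ Contains-⊆ (Sublist.++⁺ʳ _ ⊆-refl) ∷ []) ,
    (fromInterval (↭-sym β↭) , avoid ∘ Contains-⊆ (Sublist.++⁺ˡ L (_ ∷ʳ ⊆-refl)) ∘ Contains-shiftˡ c ∷ [])
  where
  shape : L ++ suc m ∷ map (_+ c) β ≡ L ⊕ ([ 1 ] ⊖ β)
  shape = trans (cong (λ n → L ++ suc n ∷ map (_+ c) β) (sym (m∸n+n≡m c≤m)))
                (cong₂ (λ b l → L ++ suc (b + l) ∷ map (_+ l) β)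
                       (sym (trans (Perm.↭-length (↭-sym β↭)) (length-interval 0 (m ∸ c))))
                       (sym (trans (Perm.↭-length L↭) (length-interval 0 c))))

max∈interval : ∀ m → suc m ∈ interval 0 (suc m)
max∈interval m = subst (suc m ∈_) (sym (interval-∷ʳ 0 m)) (∈-++⁺ʳ (interval 0 m) (here refl))

decompose : σ ↭ interval 0 (suc m) → ¬ Contains σ p231 →
            ∃₂ λ α β → σ ≡ α ⊕ ([ 1 ] ⊖ β) × Av [ p231 ] α × Av [ p231 ] β
decompose {m = m} p avoid with L , R , refl ← ∈-∃++ (Perm.∈-resp-↭ (↭-sym p) (max∈interval m)) =
  decompose-at-max p avoid

-- Av(231) as an inductive family: the decomposition α ⊕ (1 ⊖ β), read recursively.
data Tree231 : List ℕ → Set where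
  leaf : Tree231 []
  node : Tree231 α → Tree231 β → Tree231 (α ⊕ ([ 1 ] ⊖ β))

Tree231⇒Av : Tree231 σ → Av [ p231 ] σ
Tree231⇒Av leaf       = ↭-refl , (λ { (_ , [] , ()) }) ∷ []
Tree231⇒Av (node t u) = Av231-⊕-1⊖ (Tree231⇒Av t) (Tree231⇒Av u)

length-⊕-1⊖ : ∀ α β → length (α ⊕ ([ 1 ] ⊖ β)) ≡ suc (length α + length β)
length-⊕-1⊖ α β = trans (length-⊕ α ([ 1 ] ⊖ β)) (+-suc (length α) (length β))

length-⊕-1⊖-≤ : ∀ {n} α β → length (α ⊕ ([ 1 ] ⊖ β)) ≤ suc n → length α ≤ n × length β ≤ n
length-⊕-1⊖-≤ {n} α β le = m+n≤o⇒m≤o _ α+β≤n , m+n≤o⇒n≤o (length α) α+β≤n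
  where
  α+β≤n : length α + length β ≤ n
  α+β≤n = ≤-pred (subst (_≤ suc n) (length-⊕-1⊖ α β) le)

Av⇒Tree231 : Av [ p231 ] σ → Tree231 σ
Av⇒Tree231 av = build _ av ≤-refl
  where
  build : ∀ n {σ} → Av [ p231 ] σ → length σ ≤ n → Tree231 σ
  build _       {[]}    _                 _  = leaf
  build (suc n) {_ ∷ _} (p , avoid ∷ []) le with α , β , σ≡ , avα , avβ ← decompose (toInterval p) avoid =
    subst Tree231 (sym σ≡) (node (build n avα (proj₁ bounds)) (build n avβ (proj₂ bounds)))
    where
    bounds : length α ≤ n × length β ≤ n
    bounds = length-⊕-1⊖-≤ α β (subst (_≤ suc n) (cong length σ≡) le)

spanᵇ-++-∷ : ∀ (p : A → Bool) xs {y ys} → All (λ x → p x ≡ true) xs → p y ≡ false →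
             spanᵇ p (xs ++ y ∷ ys) ≡ (xs , y ∷ ys)
spanᵇ-++-∷ p []       []         py≡false rewrite py≡false = refl
spanᵇ-++-∷ p (x ∷ xs) (px≡true ∷ pxs) py≡false rewrite px≡true =
  cong (map₁ (x ∷_)) (spanᵇ-++-∷ p xs pxs py≡false)

not-≡ᵇ-≢ : ∀ {x n} → x ≢ n → not (x ≡ᵇ n) ≡ true
not-≡ᵇ-≢ {x} {n} x≢n with x ≡ᵇ n in eq
... | false = refl
... | true  = contradiction (≡ᵇ⇒≡ x n (subst T (sym eq) _)) x≢n

not-≡ᵇ-refl : ∀ n → not (n ≡ᵇ n) ≡ false
not-≡ᵇ-refl n = cong not (Equivalence.to T-≡ (≡⇒≡ᵇ n n refl))

-- Pfuel only unfolds on a syntactic cons, hence the case split on xs.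
Pfuel-suc : ∀ k xs {y ys L rest} →
            spanᵇ (λ x → not (x ≡ᵇ length (xs ++ y ∷ ys))) (xs ++ y ∷ ys) ≡ (L , rest) →
            Pfuel (suc k) (xs ++ y ∷ ys) ≡ (Pfuel k L ⊕ [ 1 ]) ⊖ Pfuel k (map (_∸ length L) (drop 1 rest))
Pfuel-suc k []      eq rewrite eq = refl
Pfuel-suc k (_ ∷ _) eq rewrite eq = refl

map-∸-+ : ∀ a xs → map (_∸ a) (map (_+ a) xs) ≡ xs
map-∸-+ a xs = trans (sym (map-∘ xs)) (trans (map-cong (λ x → m+n∸n≡m x a) xs) (map-id xs))

Pfuel-⊕-1⊖ : ∀ k → InRange α → Pfuel (suc k) (α ⊕ ([ 1 ] ⊖ β)) ≡ (Pfuel k α ⊕ [ 1 ]) ⊖ Pfuel k β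
Pfuel-⊕-1⊖ {α} {β} k rα = begin
  Pfuel (suc k) (α ++ top ∷ map (_+ length α) β)
    ≡⟨ Pfuel-suc k α (spanᵇ-++-∷ _ α (All.map α≢top rα) top≡top) ⟩
  (Pfuel k α ⊕ [ 1 ]) ⊖ Pfuel k (map (_∸ length α) (map (_+ length α) β))
    ≡⟨ cong (λ γ → (Pfuel k α ⊕ [ 1 ]) ⊖ Pfuel k γ) (map-∸-+ (length α) β) ⟩
  (Pfuel k α ⊕ [ 1 ]) ⊖ Pfuel k β ∎
  where
  open ≡-Reasoning
  top : ℕ
  top = suc (length β + length α)
  length≡top : length (α ⊕ ([ 1 ] ⊖ β)) ≡ top
  length≡top = trans (length-⊕-1⊖ α β) (cong suc (+-comm (length α) (length β)))
  top≡top : not (top ≡ᵇ length (α ⊕ ([ 1 ] ⊖ β))) ≡ false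
  top≡top = trans (cong (λ n → not (top ≡ᵇ n)) length≡top) (not-≡ᵇ-refl top)
  α≢top : ∀ {x} → 0 < x × x ≤ length α → not (x ≡ᵇ length (α ⊕ ([ 1 ] ⊖ β))) ≡ true
  α≢top (_ , x≤a) = not-≡ᵇ-≢ (<⇒≢ (≤-<-trans x≤a (subst (length α <_) (sym (length-⊕-1⊖ α β)) (s≤s (m≤m+n _ _)))))

InRange-Tree231 : Tree231 σ → InRange σ
InRange-Tree231 = IsPerm⇒InRange ∘ proj₁ ∘ Tree231⇒Av

mutual
  Pfuel-node : Tree231 α → Tree231 β → length (α ⊕ ([ 1 ] ⊖ β)) ≤ k →
               Pfuel k (α ⊕ ([ 1 ] ⊖ β)) ≡ (P α ⊕ [ 1 ]) ⊖ P β
  Pfuel-node {α} {β} {zero}  t u le with () ← subst (_≤ 0) (length-⊕-1⊖ α β) le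
  Pfuel-node {α} {β} {suc k} t u le =
    trans (Pfuel-⊕-1⊖ k (InRange-Tree231 t))
          (cong₂ (λ γ δ → (γ ⊕ [ 1 ]) ⊖ δ) (Pfuel-stable t (proj₁ bounds)) (Pfuel-stable u (proj₂ bounds)))
    where
    bounds : length α ≤ k × length β ≤ k
    bounds = length-⊕-1⊖-≤ α β le

  Pfuel-stable : Tree231 σ → length σ ≤ k → Pfuel k σ ≡ P σ
  Pfuel-stable {k = zero}  leaf       _  = refl
  Pfuel-stable {k = suc k} leaf       _  = refl
  Pfuel-stable             (node t u) le = trans (Pfuel-node t u le) (sym (Pfuel-node t u ≤-refl))

P-node : Tree231 α → Tree231 β → P (α ⊕ ([ 1 ] ⊖ β)) ≡ (P α ⊕ [ 1 ]) ⊖ P β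
P-node t u = Pfuel-node t u ≤-refl

P-Av132 : Tree231 σ → Av [ p132 ] (P σ)
P-Av132 leaf       = ↭-refl , (λ { (_ , [] , ()) }) ∷ []
P-Av132 (node t u) = subst (Av [ p132 ]) (sym (P-node t u)) (Av132-⊕1-⊖ (P-Av132 t) (P-Av132 u))

InRange-P : Tree231 σ → InRange (P σ)
InRange-P = IsPerm⇒InRange ∘ proj₁ ∘ P-Av132

⊕1-⊖-nonempty : ∀ α β → [] ≢ (α ⊕ [ 1 ]) ⊖ β
⊕1-⊖-nonempty []      _ ()
⊕1-⊖-nonempty (_ ∷ _) _ ()

++-∷-cancel : ∀ {t : A} us us′ {vs vs′} → All (_≢ t) us → All (_≢ t) us′ →
              us ++ t ∷ vs ≡ us′ ++ t ∷ vs′ → us ≡ us′ × vs ≡ vs′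
++-∷-cancel []       []        _           _           eq = refl , ∷-injectiveʳ eq
++-∷-cancel []       (_ ∷ _)   _           (u≢t ∷ _)   eq = contradiction (sym (∷-injectiveˡ eq)) u≢t
++-∷-cancel (_ ∷ _)  []        (u≢t ∷ _)   _           eq = contradiction (∷-injectiveˡ eq) u≢t
++-∷-cancel (_ ∷ us) (_ ∷ us′) (_ ∷ us≢t) (_ ∷ us′≢t) eq =
  let us≡us′ , vs≡vs′ = ++-∷-cancel us us′ us≢t us′≢t (∷-injectiveʳ eq)
  in cong₂ _∷_ (∷-injectiveˡ eq) us≡us′ , vs≡vs′

length-⊕1-⊖ : ∀ α β → length ((α ⊕ [ 1 ]) ⊖ β) ≡ suc (length α + length β)
length-⊕1-⊖ α β =
  trans (length-⊖ (α ⊕ [ 1 ]) β) (cong (_+ length β) (trans (length-⊕ α [ 1 ]) (+-comm (length α) 1)))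

⊕1-⊖-shape : ∀ α β → (α ⊕ [ 1 ]) ⊖ β ≡ map (_+ length β) α ++ suc (length α + length β) ∷ β
⊕1-⊖-shape α β = trans (cong (_++ β) (map-++ (_+ length β) α _)) (++-assoc (map (_+ length β) α) _ β)

-- The maximum of (α ⊕ 1) ⊖ β sits right after the shifted α, which stays below it; so it marks the split.
⊕1-⊖-injective : InRange α → InRange α′ → (α ⊕ [ 1 ]) ⊖ β ≡ (α′ ⊕ [ 1 ]) ⊖ β′ → α ≡ α′ × β ≡ β′
⊕1-⊖-injective {α} {α′} {β} {β′} rα rα′ eq = α≡α′ , β≡β′
  where
  top≡ : suc (length α + length β) ≡ suc (length α′ + length β′)
  top≡ = trans (sym (length-⊕1-⊖ α β)) (trans (cong length eq) (length-⊕1-⊖ α′ β′))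
  below-top : ∀ {γ} δ → InRange γ → All (_≢ suc (length γ + length δ)) (map (_+ length δ) γ)
  below-top δ rγ = All.map⁺ (All.map (λ (_ , x≤) → <⇒≢ (s≤s (+-monoˡ-≤ (length δ) x≤))) rγ)
  split : map (_+ length β) α ≡ map (_+ length β′) α′ × β ≡ β′
  split = ++-∷-cancel (map (_+ length β) α) (map (_+ length β′) α′) (below-top β rα)
            (subst (λ t → All (_≢ t) (map (_+ length β′) α′)) (sym top≡) (below-top β′ rα′))
            (trans (sym (⊕1-⊖-shape α β)) (trans eq (trans (⊕1-⊖-shape α′ β′)
                   (cong (λ t → map (_+ length β′) α′ ++ t ∷ β′) (sym top≡)))))
  β≡β′ : β ≡ β′
  β≡β′ = proj₂ split
  α≡α′ : α ≡ α′
  α≡α′ = map-injective (+-cancelʳ-≡ (length β) _ _)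
                       (trans (proj₁ split) (cong (λ b → map (_+ b) α′) (cong length (sym β≡β′))))

P-injective : Tree231 σ → Tree231 σ′ → P σ ≡ P σ′ → σ ≡ σ′
P-injective leaf       leaf         _  = refl
P-injective leaf (node {α} {β} t u) eq = ⊥-elim (⊕1-⊖-nonempty (P α) (P β) (trans eq (P-node t u)))
P-injective (node {α} {β} t u) leaf eq = ⊥-elim (⊕1-⊖-nonempty (P α) (P β) (trans (sym eq) (P-node t u)))
P-injective (node t u) (node t′ u′) eq
  with Pα≡ , Pβ≡ ← ⊕1-⊖-injective (InRange-P t) (InRange-P t′) (trans (sym (P-node t u)) (trans eq (P-node t′ u′)))
  = cong₂ (λ α β → α ⊕ ([ 1 ] ⊖ β)) (P-injective t t′ Pα≡) (P-injective u u′ Pβ≡)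

P-⊕1-⊖-preimage : Tree231 σ → InRange ρ → P σ ≡ (ρ ⊕ [ 1 ]) ⊖ ρ′ →
                  ∃₂ λ α β → σ ≡ α ⊕ ([ 1 ] ⊖ β) × Tree231 α × Tree231 β × P α ≡ ρ × P β ≡ ρ′
P-⊕1-⊖-preimage {ρ = ρ} {ρ′} leaf _ eq = ⊥-elim (⊕1-⊖-nonempty ρ ρ′ eq)
P-⊕1-⊖-preimage (node {α} {β} t u) rρ eq =
  α , β , refl , t , u , ⊕1-⊖-injective (InRange-P t) rρ (trans (sym (P-node t u)) eq)

Av-extend : Av [ q ] σ → ¬ Contains σ τ → Av (q ∷ τ ∷ []) σ
Av-extend (p , avoid ∷ []) avoidτ = p , avoid ∷ avoidτ ∷ []

Av-head : Av (q ∷ τ ∷ []) σ → Av [ q ] σ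
Av-head (p , avoid ∷ _ ∷ []) = p , avoid ∷ []

Av-avoids : Av (q ∷ τ ∷ []) σ → ¬ Contains σ τ
Av-avoids (_ , _ ∷ avoidτ ∷ []) = avoidτ

InRange-[1] : InRange [ 1 ]
InRange-[1] = IsPerm⇒InRange isPerm-[1]

Contains-⊕-1⊖⁺ˡ : InRange σ → InRange α → InRange β → Contains σ α → Contains (σ ⊕ ([ 1 ] ⊖ β)) (α ⊕ ([ 1 ] ⊖ β))
Contains-⊕-1⊖⁺ˡ rσ rα rβ c = Contains-⊕⁺ rσ rα r1⊖β r1⊖β c (Contains-refl _)
  where r1⊖β = InRange-⊖ InRange-[1] rβ

Contains-⊕-1⊖⁺ʳ : InRange α → InRange σ → InRange β → Contains σ β → Contains (α ⊕ ([ 1 ] ⊖ σ)) (α ⊕ ([ 1 ] ⊖ β))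
Contains-⊕-1⊖⁺ʳ rα rσ rβ c =
  Contains-⊕⁺ rα rα (InRange-⊖ InRange-[1] rσ) (InRange-⊖ InRange-[1] rβ) (Contains-refl _)
              (Contains-⊖⁺ InRange-[1] InRange-[1] rσ rβ (Contains-refl _) c)

Contains-⊕1-⊖⁺ˡ : InRange σ → InRange α → InRange β → Contains σ α → Contains ((σ ⊕ [ 1 ]) ⊖ β) ((α ⊕ [ 1 ]) ⊖ β)
Contains-⊕1-⊖⁺ˡ rσ rα rβ c =
  Contains-⊖⁺ (InRange-⊕ rσ InRange-[1]) (InRange-⊕ rα InRange-[1]) rβ rβ
              (Contains-⊕⁺ rσ rα InRange-[1] InRange-[1] c (Contains-refl _)) (Contains-refl _)

Contains-⊕1-⊖⁺ʳ : InRange α → InRange σ → InRange β → Contains σ β → Contains ((α ⊕ [ 1 ]) ⊖ σ) ((α ⊕ [ 1 ]) ⊖ β)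
Contains-⊕1-⊖⁺ʳ rα rσ rβ c = Contains-⊖⁺ rα⊕1 rα⊕1 rσ rβ (Contains-refl _) c
  where rα⊕1 = InRange-⊕ rα InRange-[1]

Contains-⊕-1⊖⁻ˡ : ∀ β → Contains (σ ⊕ ([ 1 ] ⊖ β)) (α ⊕ ([ 1 ] ⊖ β)) → Contains σ α
Contains-⊕-1⊖⁻ˡ β = Contains-⊕⁻ˡ ([ 1 ] ⊖ β)

Contains-⊕-1⊖⁻ʳ : ∀ α → Contains (α ⊕ ([ 1 ] ⊖ σ)) (α ⊕ ([ 1 ] ⊖ β)) → Contains σ β
Contains-⊕-1⊖⁻ʳ α = Contains-⊖⁻ʳ [ 1 ] ∘ Contains-⊕⁻ʳ α

Contains-⊕1-⊖⁻ˡ : ∀ β → Contains ((σ ⊕ [ 1 ]) ⊖ β) ((α ⊕ [ 1 ]) ⊖ β) → Contains σ α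
Contains-⊕1-⊖⁻ˡ β = Contains-⊕⁻ˡ [ 1 ] ∘ Contains-⊖⁻ˡ β

Contains-⊕1-⊖⁻ʳ : ∀ α → Contains ((α ⊕ [ 1 ]) ⊖ σ) ((α ⊕ [ 1 ]) ⊖ β) → Contains σ β
Contains-⊕1-⊖⁻ʳ α = Contains-⊖⁻ʳ (α ⊕ [ 1 ])

module _ (tα : Tree231 α) (tβ : Tree231 β) where

  private
    π : List ℕ
    π = α ⊕ ([ 1 ] ⊖ β)

  restricts-forwardˡ : RestrictsBij π → ∀ σ → Av (p231 ∷ α ∷ []) σ → Av (p132 ∷ P α ∷ []) (P σ)
  restricts-forwardˡ (forward , _) σ avσ = Av-extend (P-Av132 tσ) (avoidPπ ∘ lift)
    where
    tσ : Tree231 σ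
    tσ = Av⇒Tree231 (Av-head avσ)
    avoidPπ : ¬ Contains (P (σ ⊕ ([ 1 ] ⊖ β))) (P π)
    avoidPπ = Av-avoids (forward (σ ⊕ ([ 1 ] ⊖ β))
                (Av-extend (Tree231⇒Av (node tσ tβ)) (Av-avoids avσ ∘ Contains-⊕-1⊖⁻ˡ β)))
    lift : Contains (P σ) (P α) → Contains (P (σ ⊕ ([ 1 ] ⊖ β))) (P π)
    lift = subst₂ Contains (sym (P-node tσ tβ)) (sym (P-node tα tβ))
         ∘ Contains-⊕1-⊖⁺ˡ (InRange-P tσ) (InRange-P tα) (InRange-P tβ)

  restricts-forwardʳ : RestrictsBij π → ∀ σ → Av (p231 ∷ β ∷ []) σ → Av (p132 ∷ P β ∷ []) (P σ)
  restricts-forwardʳ (forward , _) σ avσ = Av-extend (P-Av132 tσ) (avoidPπ ∘ lift)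
    where
    tσ : Tree231 σ
    tσ = Av⇒Tree231 (Av-head avσ)
    avoidPπ : ¬ Contains (P (α ⊕ ([ 1 ] ⊖ σ))) (P π)
    avoidPπ = Av-avoids (forward (α ⊕ ([ 1 ] ⊖ σ))
                (Av-extend (Tree231⇒Av (node tα tσ)) (Av-avoids avσ ∘ Contains-⊕-1⊖⁻ʳ α)))
    lift : Contains (P σ) (P β) → Contains (P (α ⊕ ([ 1 ] ⊖ σ))) (P π)
    lift = subst₂ Contains (sym (P-node tα tσ)) (sym (P-node tα tβ))
         ∘ Contains-⊕1-⊖⁺ʳ (InRange-P tα) (InRange-P tσ) (InRange-P tβ)

  restricts-backwardˡ : RestrictsBij π → ∀ ρ → Av (p132 ∷ P α ∷ []) ρ → ∃ λ σ → Av (p231 ∷ α ∷ []) σ × P σ ≡ ρ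
  restricts-backwardˡ (_ , backward) ρ avρ = fromPreimage (backward ρ⁺ avρ⁺)
    where
    ρ⁺ : List ℕ
    ρ⁺ = (ρ ⊕ [ 1 ]) ⊖ P β
    avρ⁺ : Av (p132 ∷ P π ∷ []) ρ⁺
    avρ⁺ = Av-extend (Av132-⊕1-⊖ (Av-head avρ) (P-Av132 tβ))
                     (Av-avoids avρ ∘ Contains-⊕1-⊖⁻ˡ (P β) ∘ subst (Contains ρ⁺) (P-node tα tβ))
    fromPreimage : (∃ λ σ′ → Av (p231 ∷ π ∷ []) σ′ × P σ′ ≡ ρ⁺) → ∃ λ σ → Av (p231 ∷ α ∷ []) σ × P σ ≡ ρ
    fromPreimage (σ′ , avσ′ , Pσ′≡ρ⁺)
      with σ , β′ , refl , tσ , tβ′ , Pσ≡ρ , Pβ′≡Pβ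
             ← P-⊕1-⊖-preimage (Av⇒Tree231 (Av-head avσ′)) (IsPerm⇒InRange (proj₁ avρ)) Pσ′≡ρ⁺
      with refl ← P-injective tβ′ tβ Pβ′≡Pβ
      = σ , Av-extend (Tree231⇒Av tσ) (Av-avoids avσ′ ∘ lift) , Pσ≡ρ
      where
      lift : Contains σ α → Contains (σ ⊕ ([ 1 ] ⊖ β)) π
      lift = Contains-⊕-1⊖⁺ˡ (InRange-Tree231 tσ) (InRange-Tree231 tα) (InRange-Tree231 tβ)

  restricts-backwardʳ : RestrictsBij π → ∀ ρ → Av (p132 ∷ P β ∷ []) ρ → ∃ λ σ → Av (p231 ∷ β ∷ []) σ × P σ ≡ ρ
  restricts-backwardʳ (_ , backward) ρ avρ = fromPreimage (backward ρ⁺ avρ⁺)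
    where
    ρ⁺ : List ℕ
    ρ⁺ = (P α ⊕ [ 1 ]) ⊖ ρ
    avρ⁺ : Av (p132 ∷ P π ∷ []) ρ⁺
    avρ⁺ = Av-extend (Av132-⊕1-⊖ (P-Av132 tα) (Av-head avρ))
                     (Av-avoids avρ ∘ Contains-⊕1-⊖⁻ʳ (P α) ∘ subst (Contains ρ⁺) (P-node tα tβ))
    fromPreimage : (∃ λ σ′ → Av (p231 ∷ π ∷ []) σ′ × P σ′ ≡ ρ⁺) → ∃ λ σ → Av (p231 ∷ β ∷ []) σ × P σ ≡ ρ
    fromPreimage (σ′ , avσ′ , Pσ′≡ρ⁺)
      with α′ , σ , refl , tα′ , tσ , Pα′≡Pα , Pσ≡ρ
             ← P-⊕1-⊖-preimage (Av⇒Tree231 (Av-head avσ′)) (InRange-P tα) Pσ′≡ρ⁺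
      with refl ← P-injective tα′ tα Pα′≡Pα
      = σ , Av-extend (Tree231⇒Av tσ) (Av-avoids avσ′ ∘ lift) , Pσ≡ρ
      where
      lift : Contains σ β → Contains (α ⊕ ([ 1 ] ⊖ σ)) π
      lift = Contains-⊕-1⊖⁺ʳ (InRange-Tree231 tα) (InRange-Tree231 tσ) (InRange-Tree231 tβ)

  RestrictsBij-⊕-1⊖⁻ : RestrictsBij π → RestrictsBij α × RestrictsBij β
  RestrictsBij-⊕-1⊖⁻ h =
    (restricts-forwardˡ h , restricts-backwardˡ h) , (restricts-forwardʳ h , restricts-backwardʳ h)

mainTheorem16 : (α β : List ℕ) → Av [ p231 ] α → Av [ p231 ] β →
    RestrictsBij (α ⊕ ([ 1 ] ⊖ β)) → RestrictsBij α × RestrictsBij β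
mainTheorem16 α β avα avβ = RestrictsBij-⊕-1⊖⁻ (Av⇒Tree231 avα) (Av⇒Tree231 avβ)
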